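{- For every positive integer $n$, the independent domination polynomial $D_i(P_n,x)$ of the path $P_n$ is unimodal.
   Context: $P_n$ is the path on $n$ vertices. A set $S$ of vertices is an independent dominating set if no two vertices of $S$ are adjacent and every vertex outside $S$ has a neighbour in $S$; $d_i(G,k)$ is the number of such sets of size $k$ and $D_i(G,x)=\sum_k d_i(G,k)x^k$. A polynomial $\sum_{k=0}^N a_kx^k$ with nonnegative coefficients is unimodal if there is $m$ with $a_0\le a_1\le\dots\le a_m\ge a_{m+1}\ge\dots\ge a_N$. -}

module Defs where

open import Data.Nat using (ℕ; zero; suc; _+_; _≤_; _<_)
open import Data.Fin using (Fin; toℕ)
open import Data.Fin.Subset using (Subset; _∈_; _∉_; ∣_∣)
open import Data.Fin.Subset.Properties using (_∈?_)
open import Data.Bool using (Bool; true; false)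
open import Data.Vec using (Vec; []; _∷_)
open import Data.List using (List; []; _∷_; map; _++_; length; filter)
open import Data.Product using (Σ; ∃; _×_; _,_)
open import Relation.Binary.PropositionalEquality using (_≡_)
open import Relation.Nullary using (¬_; Dec)
open import Relation.Unary using (Decidable)
open import Relation.Nullary.Decidable using (_×-dec_; ¬?; _→-dec_)
open import Data.Sum using (_⊎_)
open import Data.Sum.Relation.Unary.All using ()
open import Data.Fin.Properties using (all?; any?)
open import Data.Nat.Properties using (_≟_)
import Data.Sum as Sum
import Relation.Nullary.Decidable as D

PathAdj : {n : ℕ} → Fin n → Fin n → Set
PathAdj i j = (suc (toℕ i) ≡ toℕ j) ⊎ (suc (toℕ j) ≡ toℕ i)

Independent : {n : ℕ} → Subset n → Set
Independent {n} S = (i j : Fin n) → i ∈ S → j ∈ S → ¬ PathAdj i j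

Dominating : {n : ℕ} → Subset n → Set
Dominating {n} S = (v : Fin n) → v ∉ S → Σ (Fin n) λ u → u ∈ S × PathAdj v u

IndDomSet : {n : ℕ} → Subset n → Set
IndDomSet S = Independent S × Dominating S

allSubsets : (n : ℕ) → List (Subset n)
allSubsets zero = [] ∷ []
allSubsets (suc n) = map (true ∷_) (allSubsets n) ++ map (false ∷_) (allSubsets n)

pathAdj? : {n : ℕ} (i j : Fin n) → Dec (PathAdj i j)
pathAdj? i j = D._⊎-dec_ (suc (toℕ i) ≟ toℕ j) (suc (toℕ j) ≟ toℕ i)

independent? : {n : ℕ} (S : Subset n) → Dec (Independent S)
independent? S = all? λ i → all? λ j →
  (i ∈? S) →-dec ((j ∈? S) →-dec ¬? (pathAdj? i j))

dominating? : {n : ℕ} (S : Subset n) → Dec (Dominating S)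
dominating? S = all? λ v → ¬? (v ∈? S) →-dec any? λ u → (u ∈? S) ×-dec pathAdj? v u

indDomOfSize? : {n : ℕ} (k : ℕ) (S : Subset n) → Dec (IndDomSet S × ∣ S ∣ ≡ k)
indDomOfSize? k S = (independent? S ×-dec dominating? S) ×-dec (∣ S ∣ ≟ k)

dᵢP : (n k : ℕ) → ℕ
dᵢP n k = length (filter (indDomOfSize? k) (allSubsets n))

Unimodal : (N : ℕ) → (ℕ → ℕ) → Set
Unimodal N a = Σ ℕ λ m → m ≤ N ×
  (((k : ℕ) → k < m → a k ≤ a (suc k)) ×
   ((k : ℕ) → m ≤ k → k < N → a (suc k) ≤ a k))

module Submission where

-- Reading a subset of P_n from left to right with a three-state scan (is the
-- previous vertex chosen, dominated, or still waiting for domination?) shows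
-- that the counts d_i(P_n, k) obey d(n+3, k+1) = d(n+1, k) + d(n, k).  We
-- work with the shifted sequence d⁺ (n+1) = d_i(P_n, ·), for which this
-- recurrence holds for all n, and solve it: d⁺ (2k+s) k = C(k+1, s), i.e.
-- binom s t with s + t = k + 1, and d⁺ L k = 0 outside 2k ≤ L ≤ 3k+1.
-- Consecutive coefficients of d⁺ L sit at (s, t) and (s−2, t+3); absorption
-- identities express their ratio, and comparing two consecutive ratios shows
-- that a strict descent is always followed by another one (or by the end of
-- the support).  A sequence whose descents persist is unimodal, with its peak
-- at the first descent.

open import Defs
open import Algebra.Properties.CommutativeSemigroup as CSProps using ()
open import Data.Bool using (Bool; true; false; not; _∧_; _∨_; T)
open import Data.Bool.Properties using (T-∧; T-∨; ∧-zeroʳ; ∧-assoc)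
open import Data.Empty using (⊥; ⊥-elim)
open import Data.Fin using (Fin; zero; suc; toℕ)
open import Data.Fin.Subset using (Subset; _∈_; _∉_; ∣_∣)
open import Data.List using ([]; _∷_; map; length; filter)
open import Data.List.Properties using (filter-++; length-++; filter-≐; filter-none)
open import Data.List.Relation.Unary.All using (universal)
open import Data.Nat
  using (ℕ; zero; suc; _+_; _*_; _∸_; _≤_; _<_; _≤′_; ≤′-refl; ≤′-step; z≤n; s≤s; z<s;
         _<?_; _≤?_; _≡ᵇ_; >-nonZero)
open import Data.Nat.Properties
open import Data.Nat.Tactic.RingSolver using (solve-∀)
open import Data.Product using (Σ; _×_; _,_; proj₁; proj₂)
open import Data.Sum using (_⊎_; inj₁; inj₂)
open import Data.Unit using (tt)
open import Data.Vec using ([]; _∷_; here; there)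
open import Function.Bundles using (Equivalence)
open import Relation.Binary.PropositionalEquality
  using (_≡_; refl; sym; trans; cong; cong₂; subst; subst₂; module ≡-Reasoning)
open import Relation.Nullary using (yes; no)
open import Relation.Nullary.Decidable using (T?; does)
open import Relation.Unary using (Pred; Decidable)

open CSProps *-commutativeSemigroup using (x∙yz≈y∙xz; xy∙z≈y∙xz)
open Equivalence using (to; from)

-- binom s t = C(s+t, s), the number of lattice paths with s steps of one
-- kind and t of the other, defined by Pascal's rule.
binom : ℕ → ℕ → ℕ
binom zero    t       = 1
binom (suc s) zero    = 1
binom (suc s) (suc t) = binom s (suc t) + binom (suc s) t

binom-pos : ∀ s t → 0 < binom s t
binom-pos zero    t       = z<s
binom-pos (suc s) zero    = z<s
binom-pos (suc s) (suc t) = <-≤-trans (binom-pos s (suc t)) (m≤m+n _ _)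

binom-sym : ∀ s t → binom s t ≡ binom t s
binom-sym zero    zero    = refl
binom-sym zero    (suc t) = refl
binom-sym (suc s) zero    = refl
binom-sym (suc s) (suc t) = begin
  binom s (suc t) + binom (suc s) t ≡⟨ cong₂ _+_ (binom-sym s (suc t)) (binom-sym (suc s) t) ⟩
  binom (suc t) s + binom t (suc s) ≡⟨ +-comm (binom (suc t) s) _ ⟩
  binom t (suc s) + binom (suc t) s ∎
  where open ≡-Reasoning

binom-one : ∀ t → binom 1 t ≡ suc t
binom-one zero    = refl
binom-one (suc t) = cong suc (binom-one t)

absorb : ∀ s t → suc s * binom (suc s) t ≡ suc (s + t) * binom s t
absorb zero    t       = trans (*-identityˡ _) (trans (binom-one t) (sym (*-identityʳ _)))
absorb (suc s) zero    = cong (λ n → suc (suc n) * 1) (sym (+-identityʳ s))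
absorb (suc s) (suc t) = begin
  suc (suc s) * (x + y + z)
    ≡⟨ distribute s x y z ⟩
  x + y + suc s * (x + y) + suc (suc s) * z
    ≡⟨ cong₂ (λ u v → x + y + u + v) (absorb s (suc t)) (absorb (suc s) t) ⟩
  x + y + suc (s + suc t) * x + suc (suc s + t) * y
    ≡⟨ collect s t x y ⟩
  suc (suc s + suc t) * (x + y) ∎
  where
  open ≡-Reasoning
  x y z : ℕ
  x = binom s (suc t)
  y = binom (suc s) t
  z = binom (suc (suc s)) t
  distribute : ∀ s a b c → suc (suc s) * (a + b + c) ≡ a + b + suc s * (a + b) + suc (suc s) * c
  distribute = solve-∀
  collect : ∀ s t a b → a + b + suc (s + suc t) * a + suc (suc s + t) * b ≡ suc (suc s + suc t) * (a + b)
  collect = solve-∀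

rising : ℕ → ℕ → ℕ
rising s zero    = 1
rising s (suc k) = suc (k + s) * rising s k

rising-pos : ∀ s k → 0 < rising s k
rising-pos s zero    = z<s
rising-pos s (suc k) = <-≤-trans (rising-pos s k) (m≤m+n _ _)

rising-mono : ∀ {s s′} k → s ≤ s′ → rising s k ≤ rising s′ k
rising-mono zero    _   = ≤-refl
rising-mono (suc k) s≤s′ = *-mono-≤ (s≤s (+-monoʳ-≤ k s≤s′)) (rising-mono k s≤s′)

absorb-rising : ∀ s t k → rising s k * binom (k + s) t ≡ rising (s + t) k * binom s t
absorb-rising s t zero    = refl
absorb-rising s t (suc k) = begin
  suc (k + s) * rising s k * binom (suc (k + s)) t
    ≡⟨ xy∙z≈y∙xz (suc (k + s)) (rising s k) (binom (suc (k + s)) t) ⟩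
  rising s k * (suc (k + s) * binom (suc (k + s)) t)
    ≡⟨ cong (rising s k *_) (absorb (k + s) t) ⟩
  rising s k * (suc (k + s + t) * binom (k + s) t)
    ≡⟨ x∙yz≈y∙xz (rising s k) (suc (k + s + t)) (binom (k + s) t) ⟩
  suc (k + s + t) * (rising s k * binom (k + s) t)
    ≡⟨ cong (suc (k + s + t) *_) (absorb-rising s t k) ⟩
  suc (k + s + t) * (rising (s + t) k * binom s t)
    ≡⟨ sym (*-assoc (suc (k + s + t)) (rising (s + t) k) (binom s t)) ⟩
  suc (k + s + t) * rising (s + t) k * binom s t
    ≡⟨ cong (λ n → suc n * rising (s + t) k * binom s t) (+-assoc k s t) ⟩
  rising (s + t) (suc k) * binom s t ∎
  where open ≡-Reasoning

absorb-risingʳ : ∀ s t k → rising t k * binom s (k + t) ≡ rising (s + t) k * binom s t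
absorb-risingʳ s t k = begin
  rising t k * binom s (k + t)   ≡⟨ cong (rising t k *_) (binom-sym s (k + t)) ⟩
  rising t k * binom (k + t) s   ≡⟨ absorb-rising t s k ⟩
  rising (t + s) k * binom t s   ≡⟨ cong₂ (λ n b → rising n k * b) (+-comm t s) (binom-sym t s) ⟩
  rising (s + t) k * binom s t   ∎
  where open ≡-Reasoning

-- The ratio of two binomials one step apart along the line (s, t) ↦ (s−2, t+3):
-- (u+t+3)(u+1)(u+2)·C(u+t+2, u+2) = (t+1)(t+2)(t+3)·C(u+t+3, u),
-- both sides being (u+t+1)(u+t+2)(u+t+3)·C(u+t, u).
ratio-identity : ∀ u t → (3 + (u + t)) * rising u 2 * binom (2 + u) t ≡ rising t 3 * binom u (3 + t)
ratio-identity u t = begin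
  (3 + (u + t)) * rising u 2 * binom (2 + u) t    ≡⟨ *-assoc (3 + (u + t)) (rising u 2) (binom (2 + u) t) ⟩
  (3 + (u + t)) * (rising u 2 * binom (2 + u) t)  ≡⟨ cong ((3 + (u + t)) *_) (absorb-rising u t 2) ⟩
  (3 + (u + t)) * (rising (u + t) 2 * binom u t)  ≡⟨ sym (*-assoc (3 + (u + t)) (rising (u + t) 2) (binom u t)) ⟩
  rising (u + t) 3 * binom u t                    ≡⟨ sym (absorb-risingʳ u t 3) ⟩
  rising t 3 * binom u (3 + t)                    ∎
  where open ≡-Reasoning

descent-transfer : ∀ {a b c p q p′ q′} → 0 < b → 0 < q →
                   p * a ≡ q * b → p′ * b ≡ q′ * c → p′ ≤ p → q ≤ q′ → b < a → c < b
descent-transfer {a} {b} {c} {p} {q} {p′} {q′} 0<b 0<q ratio ratio′ p′≤p q≤q′ b<a =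
  *-cancelˡ-< q′ c b (begin-strict
    q′ * c  ≡⟨ sym ratio′ ⟩
    p′ * b  <⟨ *-monoˡ-< b {{>-nonZero 0<b}} (≤-<-trans p′≤p (<-≤-trans p<q q≤q′)) ⟩
    q′ * b  ∎)
  where
  open ≤-Reasoning
  p<q : p < q
  p<q = *-cancelʳ-< a p q (begin-strict
    p * a  ≡⟨ ratio ⟩
    q * b  <⟨ *-monoʳ-< q {{>-nonZero 0<q}} b<a ⟩
    q * a  ∎)

weights-decrease : ∀ u t → (3 + (u + (3 + t))) * rising u 2 ≤ (3 + (2 + u + t)) * rising (2 + u) 2
weights-decrease u t = ≤-trans (m≤m+n _ _) (≤-reflexive (expand u t))
  where
  expand : ∀ u t → (3 + (u + (3 + t))) * ((2 + u) * ((1 + u) * 1))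
                     + (3 * u * u + 4 * u * t + 27 * u + 10 * t + 48)
                 ≡ (3 + (2 + u + t)) * ((4 + u) * ((3 + u) * 1))
  expand = solve-∀

binom-descent : ∀ u t → binom (2 + u) (3 + t) < binom (4 + u) t → binom u (6 + t) < binom (2 + u) (3 + t)
binom-descent u t = descent-transfer (binom-pos (2 + u) (3 + t)) (rising-pos t 3)
  (ratio-identity (2 + u) t) (ratio-identity u (3 + t))
  (weights-decrease u t) (rising-mono 3 (m≤n+m t 3))

Ascending : (ℕ → ℕ) → ℕ → Set
Ascending a m = ∀ k → k < m → a k ≤ a (suc k)

DescentsPersist : (ℕ → ℕ) → Set
DescentsPersist a = ∀ {k j} → k ≤ j → a (suc k) < a k → a (suc j) ≤ a j

persist-cong : ∀ {a b} → (∀ k → a k ≡ b k) → DescentsPersist b → DescentsPersist a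
persist-cong a≗b persist {k} {j} k≤j drop =
  subst₂ _≤_ (sym (a≗b (suc j))) (sym (a≗b j))
    (persist k≤j (subst₂ _<_ (a≗b (suc k)) (a≗b k) drop))

data FirstDescent (a : ℕ → ℕ) (N : ℕ) : Set where
  none  : Ascending a N → FirstDescent a N
  first : ∀ m → m < N → a (suc m) < a m → Ascending a m → FirstDescent a N

firstDescent : ∀ a N → FirstDescent a N
firstDescent a zero = none (λ _ ())
firstDescent a (suc N) with firstDescent a N
... | first m m<N drop asc = first m (m<n⇒m<1+n m<N) drop asc
... | none asc with a N ≤? a (suc N)
...   | no ¬rise = first N (n<1+n N) (≰⇒> ¬rise) asc
...   | yes rise = none extend
  where
  extend : Ascending a (suc N)
  extend k k<1+N with m<1+n⇒m<n∨m≡n k<1+N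
  ... | inj₁ k<N = asc k k<N
  ... | inj₂ refl = rise

-- The peak of a sequence whose descents persist is its first strict descent.
unimodal-criterion : ∀ {a} → DescentsPersist a → ∀ N → Unimodal N a
unimodal-criterion {a} persist N with firstDescent a N
... | none asc             = N , ≤-refl , asc , λ k N≤k k<N → ⊥-elim (≤⇒≯ N≤k k<N)
... | first m m<N drop asc = m , <⇒≤ m<N , asc , λ k m≤k _ → persist m≤k drop

count : ∀ n → (Subset n → Bool) → ℕ
count n f = length (filter (λ S → T? (f S)) (allSubsets n))

length-filter-map : ∀ {A B : Set} {p} {P : Pred B p} (P? : Decidable P) (g : A → B) xs →
                    length (filter P? (map g xs)) ≡ length (filter (λ x → P? (g x)) xs)
length-filter-map P? g [] = refl
length-filter-map P? g (x ∷ xs) with does (P? (g x))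
... | true  = cong suc (length-filter-map P? g xs)
... | false = length-filter-map P? g xs

count-cons : ∀ n f → count (suc n) f ≡ count n (λ S → f (true ∷ S)) + count n (λ S → f (false ∷ S))
count-cons n f = trans (cong length (filter-++ P? (map (true ∷_) (allSubsets n)) _))
  (trans (length-++ (filter P? (map (true ∷_) (allSubsets n))))
         (cong₂ _+_ (length-filter-map P? (true ∷_) (allSubsets n))
                    (length-filter-map P? (false ∷_) (allSubsets n))))
  where
  P? : Decidable (λ S → T (f S))
  P? S = T? (f S)

count-none : ∀ n f → (∀ S → f S ≡ false) → count n f ≡ 0
count-none n f never =
  cong length (filter-none (λ S → T? (f S)) (universal (λ S t → subst T (never S) t) (allSubsets n)))

-- d⁺ (n+1) k = d_i(P_n, k), shifted by one and extended by d⁺ 0 k = [k = 0]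
-- so that the path recurrence d⁺ (n+3) (k+1) = d⁺ (n+1) k + d⁺ n k holds for
-- every n.
d⁺ : ℕ → ℕ → ℕ
d⁺ 0 zero                             = 1
d⁺ 0 (suc k)                          = 0
d⁺ 1 zero                             = 1
d⁺ 1 (suc k)                          = 0
d⁺ 2 zero                             = 0
d⁺ 2 (suc k)                          = d⁺ 0 k
d⁺ (suc (suc (suc n))) zero           = 0
d⁺ (suc (suc (suc n))) (suc k)        = d⁺ (suc n) k + d⁺ n k

double-suc : ∀ k → suc k + suc k ≡ suc (suc (k + k))
double-suc k = cong suc (+-suc k k)

double-mono : ∀ {k k′} → k ≤ k′ → k + k ≤ k′ + k′
double-mono k≤k′ = +-mono-≤ k≤k′ k≤k′

triple-suc : ∀ k → suc k + suc k + suc k ≡ suc (suc (suc (k + k + k)))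
triple-suc = solve-∀

shift-index : ∀ k s → suc k + suc k + suc s ≡ suc (suc (suc (k + k + s)))
shift-index = solve-∀

-- More than half the vertices cannot be independent: d⁺ L k = 0 for L < 2k.
d⁺-past : ∀ L k → L < k + k → d⁺ L k ≡ 0
d⁺-past L                   zero          ()
d⁺-past 0                   (suc k)       _ = refl
d⁺-past 1                   (suc k)       _ = refl
d⁺-past 2                   1             (s≤s (s≤s ()))
d⁺-past 2                   (suc (suc k)) _ = refl
d⁺-past (suc (suc (suc L))) (suc k)       L+3<2k+2 =
  cong₂ _+_ (d⁺-past (suc L) k L+1<2k) (d⁺-past L k (<-trans (n<1+n L) L+1<2k))
  where
  L+1<2k : suc L < k + k
  L+1<2k = ≤-pred (≤-pred (subst (suc (suc (suc (suc L))) ≤_) (double-suc k) L+3<2k+2))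

-- Fewer than a third of the vertices cannot dominate: d⁺ L k = 0 for L > 3k+1.
d⁺-before : ∀ L k → suc (k + k + k) < L → d⁺ L k ≡ 0
d⁺-before 0                   k       ()
d⁺-before 1                   k       (s≤s ())
d⁺-before 2                   zero    _ = refl
d⁺-before 2                   (suc k) (s≤s (s≤s ()))
d⁺-before (suc (suc (suc L))) zero    _ = refl
d⁺-before (suc (suc (suc L))) (suc k) 3k+4<L+3 =
  cong₂ _+_ (d⁺-before (suc L) k (m<n⇒m<1+n 3k+1<L)) (d⁺-before L k 3k+1<L)
  where
  3k+1<L : suc (k + k + k) < L
  3k+1<L = ≤-pred (≤-pred (≤-pred
    (subst (λ n → suc (suc n) ≤ suc (suc (suc L))) (triple-suc k) 3k+4<L+3)))

d⁺-left : ∀ k → d⁺ (k + k) k ≡ 1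
d⁺-left zero          = refl
d⁺-left (suc zero)    = refl
d⁺-left (suc (suc k)) = trans (cong (λ L → d⁺ L (suc (suc k))) (double-suc (suc k)))
  (cong₂ _+_ (d⁺-left (suc k)) (d⁺-past (k + suc k) (suc k) (n<1+n _)))

d⁺-right : ∀ k → d⁺ (k + k + suc k) k ≡ 1
d⁺-right zero    = refl
d⁺-right (suc k) = trans (cong (λ L → d⁺ L (suc k)) (shift-index k (suc k)))
  (cong₂ _+_ (d⁺-before (suc (k + k + suc k)) k (s≤s (≤-reflexive (sym (+-suc (k + k) k)))))
             (d⁺-right k))

d⁺-binom : ∀ k s t → s + t ≡ suc k → d⁺ (k + k + s) k ≡ binom s t
d⁺-binom k zero t _ = trans (cong (λ L → d⁺ L k) (+-identityʳ (k + k))) (d⁺-left k)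
d⁺-binom k (suc s) zero s+1≡k+1
  with refl ← trans (sym (+-identityʳ s)) (suc-injective s+1≡k+1) = d⁺-right k
d⁺-binom zero (suc s) (suc t) s+t+2≡1 =
  ⊥-elim (1+n≢0 (trans (sym (+-suc s t)) (suc-injective s+t+2≡1)))
d⁺-binom (suc k) (suc s) (suc t) s+t+2≡k+2 = begin
  d⁺ (suc k + suc k + suc s) (suc k)
    ≡⟨ cong (λ L → d⁺ L (suc k)) (shift-index k s) ⟩
  d⁺ (suc (k + k + s)) k + d⁺ (k + k + s) k
    ≡⟨ cong (λ L → d⁺ L k + d⁺ (k + k + s) k) (sym (+-suc (k + k) s)) ⟩
  d⁺ (k + k + suc s) k + d⁺ (k + k + s) k
    ≡⟨ cong₂ _+_ (d⁺-binom k (suc s) t (trans (sym (+-suc s t)) s+t+1≡k+1))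
                 (d⁺-binom k s (suc t) s+t+1≡k+1) ⟩
  binom (suc s) t + binom s (suc t)
    ≡⟨ +-comm (binom (suc s) t) _ ⟩
  binom (suc s) (suc t) ∎
  where
  open ≡-Reasoning
  s+t+1≡k+1 : s + suc t ≡ suc k
  s+t+1≡k+1 = suc-injective s+t+2≡k+2

-- Coefficient k of d⁺ L lies inside the support, at the point (s, t) of the
-- closed form.
record SupportPoint (L k s t : ℕ) : Set where
  field
    size  : s + t ≡ suc k
    index : k + k + s ≡ L
open SupportPoint

d⁺-at : ∀ {L k s t} → SupportPoint L k s t → d⁺ L k ≡ binom s t
d⁺-at {k = k} {s} {t} p = trans (cong (λ L → d⁺ L k) (sym (index p))) (d⁺-binom k s t (size p))

data Position (L k : ℕ) : Set where
  past    : L < k + k → Position L k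
  before  : suc (k + k + k) < L → Position L k
  support : ∀ {s t} → SupportPoint L k s t → Position L k

-- For 2k ≤ L ≤ 3k+1 the support point is s = L − 2k, t = k + 1 − s.
position : ∀ L k → Position L k
position L k with L <? k + k
... | yes L<2k = past L<2k
... | no L≮2k with suc (k + k + k) <? L
...   | yes 3k+1<L = before 3k+1<L
...   | no 3k+1≮L = support (record { size = m+[n∸m]≡n s≤k+1 ; index = m+[n∸m]≡n 2k≤L })
  where
  2k≤L : k + k ≤ L
  2k≤L = ≮⇒≥ L≮2k
  s≤k+1 : L ∸ (k + k) ≤ suc k
  s≤k+1 = +-cancelˡ-≤ (k + k) _ _ (begin
    k + k + (L ∸ (k + k))  ≡⟨ m+[n∸m]≡n 2k≤L ⟩
    L                      ≤⟨ ≮⇒≥ 3k+1≮L ⟩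
    suc (k + k + k)        ≡⟨ sym (+-suc (k + k) k) ⟩
    k + k + suc k          ∎)
    where open ≤-Reasoning

-- With s ≤ 1 the next coefficient k+1 needs more than L vertices.
end-of-support : ∀ k s → s ≤ 1 → k + k + s < suc k + suc k
end-of-support k s s≤1 = begin-strict
  k + k + s          ≤⟨ +-monoʳ-≤ (k + k) s≤1 ⟩
  k + k + 1          ≡⟨ +-comm (k + k) 1 ⟩
  suc (k + k)        <⟨ n<1+n _ ⟩
  suc (suc (k + k))  ≡⟨ sym (double-suc k) ⟩
  suc k + suc k      ∎
  where open ≤-Reasoning

data NextPoint (L k : ℕ) : ℕ → ℕ → Set where
  ends  : ∀ {s t} → L < suc k + suc k → NextPoint L k s t
  moves : ∀ {s t} → SupportPoint L (suc k) s (3 + t) → NextPoint L k (2 + s) t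

nextPoint : ∀ {L k s t} → SupportPoint L k s t → NextPoint L k s t
nextPoint {k = k} {zero} p = ends (subst (_< suc k + suc k) (index p) (end-of-support k 0 z≤n))
nextPoint {k = k} {1}    p = ends (subst (_< suc k + suc k) (index p) (end-of-support k 1 ≤-refl))
nextPoint {k = k} {suc (suc s)} {t} p = moves (record
  { size  = trans (three-right s t) (cong suc (size p))
  ; index = trans (two-left k s) (index p) })
  where
  three-right : ∀ s t → s + (3 + t) ≡ 3 + (s + t)
  three-right = solve-∀
  two-left : ∀ k s → suc k + suc k + s ≡ k + k + (2 + s)
  two-left = solve-∀

Descending : ℕ → ℕ → Set
Descending L j = d⁺ L (suc j) < d⁺ L j ⊎ L < suc j + suc j

past-later : ∀ {L j} → L < suc j + suc j → L < suc (suc j) + suc (suc j)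
past-later {j = j} L<2j+2 = <-≤-trans L<2j+2 (double-mono (n≤1+n (suc j)))

-- A descent of d⁺ L is followed by another: inside the support the closed
-- form moves along (s, t) ↦ (s − 2, t + 3), where binom-descent applies.
descent-step : ∀ {L j} → Descending L j → Descending L (suc j)
descent-step (inj₂ L<2j+2) = inj₂ (past-later L<2j+2)
descent-step {L} {j} (inj₁ drop) with position L j
... | past L<2j      = ⊥-elim (n≮0 (subst (d⁺ L (suc j) <_) (d⁺-past L j L<2j) drop))
... | before 3j+1<L  = ⊥-elim (n≮0 (subst (d⁺ L (suc j) <_) (d⁺-before L j 3j+1<L) drop))
... | support {t = t} p with nextPoint p
...   | ends L<2j+2 = inj₂ (past-later L<2j+2)
...   | moves p₁ with nextPoint p₁
...     | ends L<2j+4 = inj₂ L<2j+4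
...     | moves {s = s} p₂ = inj₁ (subst₂ _<_ (sym (d⁺-at p₂)) (sym (d⁺-at p₁))
                         (binom-descent s t (subst₂ _<_ (d⁺-at p₁) (d⁺-at p) drop)))

descending-from : ∀ {L k j} → k ≤′ j → Descending L k → Descending L j
descending-from ≤′-refl          d = d
descending-from (≤′-step k≤′j) d = descent-step (descending-from k≤′j d)

d⁺-descents-persist : ∀ L → DescentsPersist (d⁺ L)
d⁺-descents-persist L {j = j} k≤j drop with descending-from (≤⇒≤′ k≤j) (inj₁ drop)
... | inj₁ drop′     = <⇒≤ drop′
... | inj₂ L<2j+2    = subst (_≤ d⁺ L j) (sym (d⁺-past L (suc j) L<2j+2)) z≤n

-- State of a left-to-right scan of S, describing the vertex left of the
-- current one.
data Scan : Set where
  chosen  : Scan   -- it lies in S: the current vertex must not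
  covered : Scan   -- it lies outside S but is dominated (or does not exist)
  exposed : Scan   -- it lies outside S undominated: the current vertex must be in S

accepts : ∀ {n} → Scan → Subset n → Bool
accepts chosen  []          = true
accepts covered []          = true
accepts exposed []          = false
accepts chosen  (true ∷ S)  = false
accepts chosen  (false ∷ S) = accepts covered S
accepts covered (true ∷ S)  = accepts chosen S
accepts covered (false ∷ S) = accepts exposed S
accepts exposed (true ∷ S)  = accepts chosen S
accepts exposed (false ∷ S) = false

ways : Scan → ℕ → ℕ → ℕ
ways X n k = count n (λ S → accepts X S ∧ (∣ S ∣ ≡ᵇ k))

ways-chosen-step : ∀ n k → ways chosen (suc n) k ≡ ways covered n k
ways-chosen-step n k =
  trans (count-cons n _) (cong (_+ ways covered n k) (count-none n _ (λ _ → refl)))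

ways-covered-step : ∀ n k → ways covered (suc n) (suc k) ≡ ways chosen n k + ways exposed n (suc k)
ways-covered-step n k = count-cons n _

ways-exposed-step : ∀ n k → ways exposed (suc n) (suc k) ≡ ways chosen n k
ways-exposed-step n k =
  trans (count-cons n _) (trans (cong (ways chosen n k +_) (count-none n _ (λ _ → refl))) (+-identityʳ _))

first-chosen-size-zero : ∀ n → count n (λ S → accepts chosen S ∧ (suc ∣ S ∣ ≡ᵇ 0)) ≡ 0
first-chosen-size-zero n = count-none n _ (λ S → ∧-zeroʳ (accepts chosen S))

ways-exposed-zero : ∀ n → ways exposed n 0 ≡ 0
ways-exposed-zero zero    = refl
ways-exposed-zero (suc n) =
  trans (count-cons n _) (cong₂ _+_ (first-chosen-size-zero n) (count-none n _ (λ _ → refl)))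

ways-covered-zero : ∀ n → ways covered (suc n) 0 ≡ 0
ways-covered-zero n = trans (count-cons n _) (cong₂ _+_ (first-chosen-size-zero n) (ways-exposed-zero n))

-- The transfer equations are those of d⁺: started after a chosen vertex the
-- scan counts d⁺ n, started at the left end it counts d⁺ (n+1) = d_i(P_n, ·).
ways-chosen  : ∀ n k → ways chosen n k ≡ d⁺ n k
ways-covered : ∀ n k → ways covered n k ≡ d⁺ (suc n) k

ways-chosen zero    zero    = refl
ways-chosen zero    (suc k) = refl
ways-chosen (suc n) k       = trans (ways-chosen-step n k) (ways-covered n k)

ways-covered zero          zero    = refl
ways-covered zero          (suc k) = refl
ways-covered (suc zero)    zero    = ways-covered-zero 0
ways-covered (suc (suc n)) zero    = ways-covered-zero (suc n)
ways-covered (suc zero)    (suc k) = trans (ways-covered-step 0 k) (trans (+-identityʳ _) (ways-chosen 0 k))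
ways-covered (suc (suc n)) (suc k) = trans (ways-covered-step (suc n) k)
  (cong₂ _+_ (ways-chosen (suc n) k) (trans (ways-exposed-step n k) (ways-chosen n k)))

headBit : ∀ {n} → Subset n → Bool
headBit []      = false
headBit (b ∷ _) = b

noAdjacent : ∀ {n} → Subset n → Bool
noAdjacent []      = true
noAdjacent (b ∷ S) = not (b ∧ headBit S) ∧ noAdjacent S

-- Every vertex outside S has a neighbour in S, where the flag l tells
-- whether a (virtual) left neighbour of vertex 0 lies in S.
dominatedAfter : ∀ {n} → Bool → Subset n → Bool
dominatedAfter l []      = true
dominatedAfter l (b ∷ S) = (b ∨ l ∨ headBit S) ∧ dominatedAfter b S

scanSpec : ∀ {n} → Scan → Subset n → Bool
scanSpec chosen  S = not (headBit S) ∧ noAdjacent S ∧ dominatedAfter true S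
scanSpec covered S = noAdjacent S ∧ dominatedAfter false S
scanSpec exposed S = headBit S ∧ noAdjacent S ∧ dominatedAfter false S

∧-exchange : ∀ x y z → x ∧ (y ∧ z) ≡ y ∧ (x ∧ z)
∧-exchange true  y z = refl
∧-exchange false true  z = refl
∧-exchange false false z = refl

accepts-spec : ∀ {n} X (S : Subset n) → accepts X S ≡ scanSpec X S
accepts-spec chosen  []          = refl
accepts-spec covered []          = refl
accepts-spec exposed []          = refl
accepts-spec chosen  (true ∷ S)  = refl
accepts-spec chosen  (false ∷ S) = accepts-spec covered S
accepts-spec covered (true ∷ S)  =
  trans (accepts-spec chosen S) (sym (∧-assoc (not (headBit S)) (noAdjacent S) (dominatedAfter true S)))
accepts-spec covered (false ∷ S) =
  trans (accepts-spec exposed S) (∧-exchange (headBit S) (noAdjacent S) (dominatedAfter false S))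
accepts-spec exposed (true ∷ S)  =
  trans (accepts-spec chosen S) (sym (∧-assoc (not (headBit S)) (noAdjacent S) (dominatedAfter true S)))
accepts-spec exposed (false ∷ S) = refl

adj-suc : ∀ {n} {i j : Fin n} → PathAdj i j → PathAdj {suc n} (suc i) (suc j)
adj-suc (inj₁ e) = inj₁ (cong suc e)
adj-suc (inj₂ e) = inj₂ (cong suc e)

adj-pred : ∀ {n} {i j : Fin n} → PathAdj {suc n} (suc i) (suc j) → PathAdj i j
adj-pred (inj₁ e) = inj₁ (suc-injective e)
adj-pred (inj₂ e) = inj₂ (suc-injective e)

adj-sym : ∀ {n} {i j : Fin n} → PathAdj i j → PathAdj j i
adj-sym (inj₁ e) = inj₂ e
adj-sym (inj₂ e) = inj₁ e

adj-zero : ∀ {n} {j : Fin n} → PathAdj {suc n} zero (suc j) → toℕ j ≡ 0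
adj-zero (inj₁ e) = sym (suc-injective e)
adj-zero (inj₂ ())

head-set : ∀ {n} {S : Subset (suc n)} → zero ∈ S → T (headBit S)
head-set here = tt

set-head : ∀ {n b} {S : Subset n} → T b → zero ∈ (b ∷ S)
set-head {b = true} _ = here

clash : ∀ {n} {S : Subset n} {j} → T (noAdjacent (true ∷ S)) → j ∈ S → toℕ j ≡ 0 → ⊥
clash ok here      refl = ok
clash ok (there _) ()

noAdjacent-sound : ∀ {n} (S : Subset n) → T (noAdjacent S) → Independent S
noAdjacent-sound []      _  ()
noAdjacent-sound (b ∷ S) ok zero    zero    _          _          (inj₁ ())
noAdjacent-sound (b ∷ S) ok zero    zero    _          _          (inj₂ ())
noAdjacent-sound (b ∷ S) ok zero    (suc j) here       (there j∈) adj = clash ok j∈ (adj-zero adj)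
noAdjacent-sound (b ∷ S) ok (suc i) zero    (there i∈) here       adj = clash ok i∈ (adj-zero (adj-sym adj))
noAdjacent-sound (b ∷ S) ok (suc i) (suc j) (there i∈) (there j∈) adj =
  noAdjacent-sound S (proj₂ (to T-∧ ok)) i j i∈ j∈ (adj-pred adj)

noAdjacent-complete : ∀ {n} (S : Subset n) → Independent S → T (noAdjacent S)
noAdjacent-complete []      _   = tt
noAdjacent-complete (b ∷ S) ind = from T-∧ (firstPair b S ind , noAdjacent-complete S indTail)
  where
  firstPair : ∀ {n} b (R : Subset n) → Independent (b ∷ R) → T (not (b ∧ headBit R))
  firstPair false R           _   = tt
  firstPair true  []          _   = tt
  firstPair true  (false ∷ R) _   = tt
  firstPair true  (true ∷ R)  ind = ind zero (suc zero) here (there here) (inj₁ refl)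
  indTail : Independent S
  indTail i j i∈ j∈ adj = ind (suc i) (suc j) (there i∈) (there j∈) (adj-suc adj)

DominatedAfter : ∀ {n} → Bool → Subset n → Set
DominatedAfter {n} l S =
  (v : Fin n) → v ∉ S → (T l × toℕ v ≡ 0) ⊎ Σ (Fin n) λ u → u ∈ S × PathAdj v u

dominatedAfter-sound : ∀ {n} l (S : Subset n) → T (dominatedAfter l S) → DominatedAfter l S
dominatedAfter-sound l (b ∷ S) ok zero 0∉ = vertexZero b l S (proj₁ (to T-∧ ok)) 0∉
  where
  vertexZero : ∀ {n} b l (R : Subset n) → T (b ∨ l ∨ headBit R) → zero ∉ (b ∷ R)
             → (T l × 0 ≡ 0) ⊎ Σ (Fin (suc n)) λ u → u ∈ (b ∷ R) × PathAdj zero u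
  vertexZero true  l     R           _  0∉ = ⊥-elim (0∉ here)
  vertexZero false true  R           _  _  = inj₁ (tt , refl)
  vertexZero false false (true ∷ R)  _  _  = inj₂ (suc zero , there here , inj₁ refl)
  vertexZero false false (false ∷ R) () _
  vertexZero false false []          () _
dominatedAfter-sound l (b ∷ S) ok (suc v) v∉
  with dominatedAfter-sound b S (proj₂ (to T-∧ ok)) v (λ v∈ → v∉ (there v∈))
... | inj₁ (b-set , v≡0)  = inj₂ (zero , set-head b-set , inj₂ (cong suc (sym v≡0)))
... | inj₂ (u , u∈ , adj) = inj₂ (suc u , there u∈ , adj-suc adj)

dominatedAfter-complete : ∀ {n} l (S : Subset n) → DominatedAfter l S → T (dominatedAfter l S)
dominatedAfter-complete l []      _   = tt
dominatedAfter-complete l (b ∷ S) dom = from T-∧ (vertexZero b dom , dominatedAfter-complete b S rest)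
  where
  vertexZero : ∀ b → DominatedAfter l (b ∷ S) → T (b ∨ l ∨ headBit S)
  vertexZero true  _ = tt
  vertexZero false dom with dom zero (λ ())
  ... | inj₁ (l-set , _)                 = from T-∨ (inj₁ l-set)
  ... | inj₂ (zero , () , _)
  ... | inj₂ (suc zero , there 0∈S , _)  = from T-∨ (inj₂ (head-set 0∈S))
  ... | inj₂ (suc (suc u) , _ , adj) with () ← adj-zero adj
  rest : DominatedAfter b S
  rest v v∉ with dom (suc v) (λ { (there v∈) → v∉ v∈ })
  ... | inj₁ (_ , ())
  ... | inj₂ (zero , here , adj)        = inj₁ (tt , adj-zero (adj-sym adj))
  ... | inj₂ (suc u , there u∈ , adj)   = inj₂ (u , u∈ , adj-pred adj)

accepts-sound : ∀ {n} (S : Subset n) → T (accepts covered S) → IndDomSet S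
accepts-sound S ok with to T-∧ (subst T (accepts-spec covered S) ok)
... | ind , dom = noAdjacent-sound S ind , dominating
  where
  dominating : Dominating S
  dominating v v∉ with dominatedAfter-sound false S dom v v∉
  ... | inj₁ (() , _)
  ... | inj₂ neighbour = neighbour

accepts-complete : ∀ {n} (S : Subset n) → IndDomSet S → T (accepts covered S)
accepts-complete S (ind , dom) = subst T (sym (accepts-spec covered S))
  (from T-∧ (noAdjacent-complete S ind , dominatedAfter-complete false S (λ v v∉ → inj₂ (dom v v∉))))

dᵢP-ways : ∀ n k → dᵢP n k ≡ ways covered n k
dᵢP-ways n k = cong length
  (filter-≐ (indDomOfSize? k) (λ S → T? (accepts covered S ∧ (∣ S ∣ ≡ᵇ k))) (into , onto) (allSubsets n))
  where
  into : ∀ {S : Subset n} → IndDomSet S × ∣ S ∣ ≡ k → T (accepts covered S ∧ (∣ S ∣ ≡ᵇ k))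
  into {S} (isIDS , |S|≡k) = from T-∧ (accepts-complete S isIDS , ≡⇒≡ᵇ _ _ |S|≡k)
  onto : ∀ {S : Subset n} → T (accepts covered S ∧ (∣ S ∣ ≡ᵇ k)) → IndDomSet S × ∣ S ∣ ≡ k
  onto {S} ok with to T-∧ ok
  ... | accepted , |S|≡k = accepts-sound S accepted , ≡ᵇ⇒≡ _ _ |S|≡k

dᵢP≡d⁺ : ∀ n k → dᵢP n k ≡ d⁺ (suc n) k
dᵢP≡d⁺ n k = trans (dᵢP-ways n k) (ways-covered n k)

mainTheorem14 : (n : ℕ) → Unimodal (suc n) (dᵢP (suc n))
mainTheorem14 n =
  unimodal-criterion (persist-cong (dᵢP≡d⁺ (suc n)) (d⁺-descents-persist (suc (suc n)))) (suc n)
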